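{- For every $n\ge 3$, the cycle graph $C_n$ on $n$ vertices is not in $\mathcal{U}$.
   Context: A clause is a disjunction of literals (Boolean variables or their negations); a reduced 2-CNF is a conjunction of clauses each consisting of exactly two literals on two distinct variables, with no repeated clause. With $|x|=|\neg x|=x$, the associated multigraph of such a CNF has as vertices the variables occurring in it and one edge $\{|a|,|b|\}$ per clause $(a\vee b)$; the CNF is simple if it has no multiple edges, in which case the graph is denoted $\mathcal{G}(S)$. $\mathcal{U}$ is the family of graphs $\mathcal{G}(S)$ with $S$ an unsatisfiable simple 2-CNF. -}

module Defs where

open import Data.Nat using (ℕ; _%_; _≥_; suc; _≟_)
open import Data.Bool using (Bool; true; false; T; _∨_; not; if_then_else_)
open import Data.Fin using (Fin; toℕ)
open import Data.Product using (Σ; _×_; _,_; proj₁; proj₂; ∃)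
open import Data.Sum using (_⊎_)
open import Data.List using (List; length; lookup)
open import Data.Bool.ListAction using (any)
open import Relation.Nullary using (¬_; does)
open import Relation.Binary.PropositionalEquality using (_≡_; _≢_)
open import Function using (_∘_)

-- Variables are natural numbers.  A literal is a variable together with a
-- polarity (true = positive literal x, false = negated literal ¬x).
Lit : Set
Lit = ℕ × Bool

∣_∣ˡ : Lit → ℕ
∣ a ∣ˡ = proj₁ a

record Clause : Set where
  constructor ⟨_∨_∣_⟩
  field
    fst : Lit
    snd : Lit
    distinct : ∣ fst ∣ˡ ≢ ∣ snd ∣ˡ
open Clause public

CNF : Set
CNF = List Clause

SameClause : Clause → Clause → Set
SameClause c d = (fst c ≡ fst d × snd c ≡ snd d) ⊎ (fst c ≡ snd d × snd c ≡ fst d)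

EdgeOf : Clause → ℕ → ℕ → Set
EdgeOf c u v = (∣ fst c ∣ˡ ≡ u × ∣ snd c ∣ˡ ≡ v) ⊎ (∣ fst c ∣ˡ ≡ v × ∣ snd c ∣ˡ ≡ u)

SameEdge : Clause → Clause → Set
SameEdge c d = EdgeOf d ∣ fst c ∣ˡ ∣ snd c ∣ˡ

Reduced : CNF → Set
Reduced S = (i j : Fin (length S)) → SameClause (lookup S i) (lookup S j) → i ≡ j

Simple : CNF → Set
Simple S = (i j : Fin (length S)) → SameEdge (lookup S i) (lookup S j) → i ≡ j

Assignment : Set
Assignment = ℕ → Bool

evalLit : Assignment → Lit → Bool
evalLit σ (x , true)  = σ x
evalLit σ (x , false) = not (σ x)

SatClause : Assignment → Clause → Set
SatClause σ c = T (evalLit σ (fst c) ∨ evalLit σ (snd c))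

Satisfiable : CNF → Set
Satisfiable S = Σ Assignment λ σ → (i : Fin (length S)) → SatClause σ (lookup S i)

Unsatisfiable : CNF → Set
Unsatisfiable S = ¬ Satisfiable S

record Graph : Set₁ where
  field
    V   : Set
    Adj : V → V → Set
open Graph public

record _≅_ (G H : Graph) : Set where
  field
    to       : V G → V H
    from     : V H → V G
    from-to  : ∀ u → from (to u) ≡ u
    to-from  : ∀ v → to (from v) ≡ v
    adj-to   : ∀ u v → Adj G u v → Adj H (to u) (to v)
    adj-from : ∀ u v → Adj H (to u) (to v) → Adj G u v

-- Does variable x occur in clause c / in S?  (Boolean, so vertex proofs are unique.)
occursC : ℕ → Clause → Bool
occursC x c = does (x ≟ ∣ fst c ∣ˡ) ∨ does (x ≟ ∣ snd c ∣ˡ)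

occurs : ℕ → CNF → Bool
occurs x S = any (occursC x) S

𝒢 : CNF → Graph
𝒢 S = record
  { V   = Σ ℕ (λ x → T (occurs x S))
  ; Adj = λ u v → Σ (Fin (length S)) λ i → EdgeOf (lookup S i) (proj₁ u) (proj₁ v)
  }

-- The family 𝒰 (closed under isomorphism): G ∈ 𝒰 iff G ≅ 𝒢(S) for some
-- reduced simple unsatisfiable 2-CNF S.
InU : Graph → Set
InU G = Σ CNF λ S → Reduced S × Simple S × Unsatisfiable S × (G ≅ 𝒢 S)

CycSucc : (n : ℕ) → Fin n → Fin n → Set
CycSucc n i j = (toℕ j ≡ suc (toℕ i)) ⊎ (suc (toℕ i) ≡ n × toℕ j ≡ 0)

Cycle : ℕ → Graph
Cycle n = record
  { V   = Fin n
  ; Adj = λ i j → CycSucc n i j ⊎ CycSucc n j i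
  }

-- Orient every edge of 𝒢(S) and let each clause be responsible for the
-- variable at the head of its edge.  In a cycle, oriented cyclically, every
-- vertex is the head of exactly one edge, so with S simple distinct clauses
-- get distinct variables, and each clause can be satisfied through its own
-- variable.  This works for any graph with an orientation of in-degree ≤ 1.
module Submission where

open import Defs
open import Data.Nat using (ℕ; _≥_; _≟_)
open import Data.Nat.Properties using (suc-injective; 0≢1+n; ≟-diag)
open import Data.Bool using (true; false; T)
open import Data.Bool.Properties using (T-∨; T-irrelevant)
open import Data.Unit using (tt)
open import Data.Empty using (⊥-elim)
open import Data.Fin using (Fin)
open import Data.Fin.Properties using (toℕ-injective; any?)
open import Data.Product using (Σ; _×_; _,_; proj₁; proj₂)
open import Data.Product.Properties using (Σ-≡,≡→≡)
open import Data.Sum using (_⊎_; inj₁; inj₂)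
open import Data.List using (length; lookup)
open import Data.List.Membership.Propositional using (lose)
open import Data.List.Membership.Propositional.Properties using (∈-lookup)
open import Data.List.Relation.Unary.Any.Properties using (any⁺)
open import Function using (_∘_; id; Equivalence)
open import Relation.Nullary using (¬_; does; yes; no)
open import Relation.Binary.PropositionalEquality

data _∈ᶜ_ : Lit → Clause → Set where
  first  : ∀ {c} → fst c ∈ᶜ c
  second : ∀ {c} → snd c ∈ᶜ c

evalLit-true : ∀ σ l → σ ∣ l ∣ˡ ≡ proj₂ l → T (evalLit σ l)
evalLit-true σ (x , true)  σx≡b rewrite σx≡b = tt
evalLit-true σ (x , false) σx≡b rewrite σx≡b = tt

satClause-∈ᶜ : ∀ σ {l c} → l ∈ᶜ c → T (evalLit σ l) → SatClause σ c
satClause-∈ᶜ σ first  t = Equivalence.from T-∨ (inj₁ t)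
satClause-∈ᶜ σ second t = Equivalence.from T-∨ (inj₂ t)

satisfiable-of-distinct-variables :
  (S : CNF) (pick : Fin (length S) → Lit) →
  (∀ k → pick k ∈ᶜ lookup S k) →
  (∀ k k′ → ∣ pick k ∣ˡ ≡ ∣ pick k′ ∣ˡ → k ≡ k′) →
  Satisfiable S
satisfiable-of-distinct-variables S pick pick∈ pick-injective = σ , sat
  where
  σ : Assignment
  σ x with any? (λ k → ∣ pick k ∣ˡ ≟ x)
  ... | yes (k , _) = proj₂ (pick k)
  ... | no _        = false

  σ-pick : ∀ k → σ ∣ pick k ∣ˡ ≡ proj₂ (pick k)
  σ-pick k with any? (λ k′ → ∣ pick k′ ∣ˡ ≟ ∣ pick k ∣ˡ)
  ... | yes (k′ , e) = cong (proj₂ ∘ pick) (pick-injective k′ k e)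
  ... | no none      = ⊥-elim (none (k , refl))

  sat : ∀ k → SatClause σ (lookup S k)
  sat k = satClause-∈ᶜ σ (pick∈ k) (evalLit-true σ (pick k) (σ-pick k))

head-literal : ∀ c {u v} → EdgeOf c u v → Σ Lit λ l → l ∈ᶜ c × ∣ l ∣ˡ ≡ v
head-literal c (inj₁ (_ , e)) = snd c , second , e
head-literal c (inj₂ (e , _)) = fst c , first  , e

EdgeOf-sym : ∀ c {u v} → EdgeOf c u v → EdgeOf c v u
EdgeOf-sym c (inj₁ e) = inj₂ e
EdgeOf-sym c (inj₂ e) = inj₁ e

sameEdge-of-EdgeOf : ∀ c d {u v} → EdgeOf c u v → EdgeOf d u v → SameEdge c d
sameEdge-of-EdgeOf c d (inj₁ (refl , refl)) e = e
sameEdge-of-EdgeOf c d (inj₂ (refl , refl)) e = EdgeOf-sym d e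

occurs-lookup : ∀ S k x → T (occursC x (lookup S k)) → T (occurs x S)
occurs-lookup S k x = any⁺ {xs = S} (occursC x) ∘ lose {P = T ∘ occursC x} (∈-lookup {xs = S} k)

T-≟-refl : ∀ x → T (does (x ≟ x))
T-≟-refl x = subst (T ∘ does) (sym (≟-diag {x} refl)) tt

occursC-fst : ∀ c → T (occursC ∣ fst c ∣ˡ c)
occursC-fst c = Equivalence.from (T-∨ {y = does (∣ fst c ∣ˡ ≟ ∣ snd c ∣ˡ)}) (inj₁ (T-≟-refl ∣ fst c ∣ˡ))

occursC-snd : ∀ c → T (occursC ∣ snd c ∣ˡ c)
occursC-snd c = Equivalence.from (T-∨ {x = does (∣ snd c ∣ˡ ≟ ∣ fst c ∣ˡ)}) (inj₂ (T-≟-refl ∣ snd c ∣ˡ))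

𝒢-vertex-≡ : ∀ {S} {u v : V (𝒢 S)} → proj₁ u ≡ proj₁ v → u ≡ v
𝒢-vertex-≡ refl = Σ-≡,≡→≡ (refl , T-irrelevant _ _)

module _ (G : Graph) (R : V G → V G → Set)
         (orient : ∀ {u v} → Adj G u v → R u v ⊎ R v u)
         (R-pred-unique : ∀ {a a′ i} → R a i → R a′ i → a ≡ a′)
         (S : CNF) (simple : Simple S) (iso : G ≅ 𝒢 S) where
  open _≅_ iso

  var-of : V G → ℕ
  var-of = proj₁ ∘ to

  record Arc (c : Clause) : Set where
    field
      tail head : V G
      arc       : R tail head
      edge      : EdgeOf c (var-of tail) (var-of head)
  open Arc

  arc-of : ∀ k → Arc (lookup S k)
  arc-of k = orient-arc (orient (adj-from iu iv (k , edge-uv)))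
    where
    c : Clause
    c = lookup S k
    u v : V (𝒢 S)
    u = ∣ fst c ∣ˡ , occurs-lookup S k ∣ fst c ∣ˡ (occursC-fst c)
    v = ∣ snd c ∣ˡ , occurs-lookup S k ∣ snd c ∣ˡ (occursC-snd c)
    iu iv : V G
    iu = from u
    iv = from v
    edge-uv : EdgeOf c (var-of iu) (var-of iv)
    edge-uv = inj₁ (sym (cong proj₁ (to-from u)) , sym (cong proj₁ (to-from v)))
    orient-arc : R iu iv ⊎ R iv iu → Arc c
    orient-arc (inj₁ r) = record { arc = r ; edge = edge-uv }
    orient-arc (inj₂ r) = record { arc = r ; edge = EdgeOf-sym c edge-uv }

  head-literal-of : ∀ k → Σ Lit λ l → l ∈ᶜ lookup S k × ∣ l ∣ˡ ≡ var-of (head (arc-of k))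
  head-literal-of k = head-literal (lookup S k) (edge (arc-of k))

  pick : Fin (length S) → Lit
  pick = proj₁ ∘ head-literal-of

  ∣pick∣≡head : ∀ k → ∣ pick k ∣ˡ ≡ var-of (head (arc-of k))
  ∣pick∣≡head = proj₂ ∘ proj₂ ∘ head-literal-of

  to-injective : ∀ {u v} → to u ≡ to v → u ≡ v
  to-injective {u} {v} e = trans (sym (from-to u)) (trans (cong from e) (from-to v))

  pick-injective : ∀ k k′ → ∣ pick k ∣ˡ ≡ ∣ pick k′ ∣ˡ → k ≡ k′
  pick-injective k k′ e = simple k k′ (sameEdge-of-EdgeOf (lookup S k) (lookup S k′) (edge a) edge′)
    where
    a  = arc-of k
    a′ = arc-of k′
    heads : head a ≡ head a′
    heads = to-injective (𝒢-vertex-≡ {S} (trans (sym (∣pick∣≡head k)) (trans e (∣pick∣≡head k′))))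
    tails : tail a′ ≡ tail a
    tails = R-pred-unique (subst (R (tail a′)) (sym heads) (arc a′)) (arc a)
    edge′ : EdgeOf (lookup S k′) (var-of (tail a)) (var-of (head a))
    edge′ = subst₂ (λ t h → EdgeOf (lookup S k′) (var-of t) (var-of h))
                   tails (sym heads) (edge a′)

  satisfiable-of-orientation : Satisfiable S
  satisfiable-of-orientation =
    satisfiable-of-distinct-variables S pick (proj₁ ∘ proj₂ ∘ head-literal-of) pick-injective

CycSucc-pred-unique : ∀ {n} {a a′ i : Fin n} → CycSucc n a i → CycSucc n a′ i → a ≡ a′
CycSucc-pred-unique (inj₁ e) (inj₁ e′) = toℕ-injective (suc-injective (trans (sym e) e′))
CycSucc-pred-unique (inj₁ e) (inj₂ (_ , e′)) = ⊥-elim (0≢1+n (trans (sym e′) e))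
CycSucc-pred-unique (inj₂ (_ , e)) (inj₁ e′) = ⊥-elim (0≢1+n (trans (sym e) e′))
CycSucc-pred-unique (inj₂ (e , _)) (inj₂ (e′ , _)) = toℕ-injective (suc-injective (trans e (sym e′)))

corollary9 : (n : ℕ) → n ≥ 3 → ¬ InU (Cycle n)
corollary9 n _ (S , _ , simple , unsat , iso) =
  unsat (satisfiable-of-orientation (Cycle n) (CycSucc n) id
           CycSucc-pred-unique S simple iso)
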